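{- Let $q$ be a positive integer and consider an instance of \textsc{Min-Lin-Eq}$(q)$-\textsc{Full} on the complete graph $G=(V,E)$. The Pivot Algorithm is a $3$-approximation algorithm: the expected number of constraints left unsatisfied by its output is at most $3$ times the minimum number of unsatisfied constraints over all assignments.
   Context: \textsc{Min-Lin-Eq}$(q)$-\textsc{Full}: given the complete simple graph $G=(V,E)$ on $n$ vertices, a positive integer $q$, and for each ordered pair of distinct vertices $(u,v)$ an integer $c_{uv}\in[q]=\{0,\dots,q-1\}$ with $c_{vu}=q-c_{uv}\bmod q$, each edge $uv$ carries the constraint $x_u-x_v\equiv c_{uv}\pmod q$. An assignment is a map $x:V\to[q]$; the goal is to find a minimum-cardinality set of edges whose deletion leaves a satisfiable set of constraints (equivalently, minimize the number of constraints unsatisfied by an assignment). Pivot Algorithm: pick a pivot $p\in V$ uniformly at random, label $p$ with $0$, and label each $v\in V\setminus\{p\}$ with $\ell(v)=c_{vp}$; output the labeling $\ell$ (the deleted edges are those whose constraints $\ell$ violates). -}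

module Defs where

open import Data.Nat using (ℕ; zero; suc; _+_; _*_; _∸_; _%_; _<_; NonZero)
open import Data.Nat.Properties using (_<?_)
open import Data.Fin using (Fin; toℕ; zero; suc)
open import Data.Fin.Properties using (_≟_)
open import Relation.Nullary using (Dec; yes; no; ¬_)
open import Relation.Binary.PropositionalEquality using (_≡_; _≢_)

Σ[Fin] : ∀ {n} → (Fin n → ℕ) → ℕ
Σ[Fin] {zero}  f = 0
Σ[Fin] {suc n} f = f zero + Σ[Fin] (λ i → f (suc i))

-- An instance of Min-Lin-Eq(q)-Full on the complete graph with vertex set Fin n:
-- c u v ∈ [q] for each ordered pair (values on the diagonal are irrelevant),
-- with c v u = (q - c u v) mod q for u ≠ v.
Consistent : (q n : ℕ) → .{{_ : NonZero q}} → (Fin n → Fin n → Fin q) → Set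
Consistent q n c = ∀ u v → u ≢ v → toℕ (c v u) ≡ (q ∸ toℕ (c u v)) % q

Satisfied : ∀ {q n} → .{{_ : NonZero q}} → (Fin n → Fin n → Fin q) → (Fin n → Fin q) → Fin n → Fin n → Set
Satisfied {q} c x u v = (toℕ (x u) + q ∸ toℕ (x v)) % q ≡ toℕ (c u v)

satisfied? : ∀ {q n} → .{{_ : NonZero q}} → (c : Fin n → Fin n → Fin q) → (x : Fin n → Fin q) → ∀ u v → Dec (Satisfied c x u v)
satisfied? {q} c x u v = (toℕ (x u) + q ∸ toℕ (x v)) % q Data.Nat.≟ toℕ (c u v)

unsat : ∀ {q n} → .{{_ : NonZero q}} → (Fin n → Fin n → Fin q) → (Fin n → Fin q) → ℕ
unsat c x = Σ[Fin] λ u → Σ[Fin] λ v → ind u v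
  where
  ind : _ → _ → ℕ
  ind u v with toℕ u <? toℕ v | satisfied? c x u v
  ... | yes _ | no _ = 1
  ... | _     | _    = 0

pivotLabel : ∀ {q n} → .{{_ : NonZero q}} → (Fin n → Fin n → Fin q) → Fin n → (Fin n → Fin q)
pivotLabel {suc q} c p v with v ≟ p
... | yes _ = zero
... | no  _ = c v p

-- Fix any assignment x and a pivot p. If x satisfies all three edges of a triangle uvp, then
-- c_up − c_vp ≡ c_uv, which is exactly the constraint on uv for the pivot labelling ℓ_p. So every
-- edge violated by ℓ_p but not by x can be charged to an edge up or vp violated by x, and an edge
-- wp is charged at most n times; hence unsat(ℓ_p) ≤ unsat(x) + n·deg_x(p), where deg_x(p) counts
-- the violated edges at p. Summing over p, the degrees add up to 2·unsat(x), giving 3n·unsat(x).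
module Submission where

open import Defs
open import Algebra.Properties.CommutativeMonoid.Sum as ℕ-Sum using ()
open import Data.Fin using (Fin; toℕ; zero; suc)
open import Data.Fin.Properties using (_≟_; toℕ<n; <-cmp; <⇒≢)
open import Data.Nat using (ℕ; zero; suc; _+_; _*_; _∸_; _%_; _≤_; _<_; z≤n; NonZero; pred)
open import Data.Nat.DivMod using (%-distribˡ-+; m%n%n≡m%n; [m+n]%n≡m%n; [m+kn]%n≡m%n; m<n⇒m%n≡m)
open import Data.Nat.Properties
  using ( _<?_; +-0-commutativeMonoid; module ≤-Reasoning; ≤-refl; ≤-reflexive; ≤-trans; <⇒≤; <-asym
        ; +-comm; +-assoc; *-suc; *-zeroʳ; *-identityˡ; *-distribˡ-+; *-distribʳ-+; suc-pred; m∸n+n≡m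
        ; +-mono-≤; +-monoʳ-≤; *-monoˡ-≤; m≤m+n; m≤n+m; m+n≡0⇒m≡0; m+n≡0⇒n≡0; n≢0⇒n>0 )
  renaming (_≟_ to _≟ℕ_)
open import Data.Nat.Tactic.RingSolver using (solve-∀)
open import Data.Empty using (⊥-elim)
open import Data.Product using (_×_; _,_; proj₁; proj₂)
open import Function using (_∘_; flip; _⇔_; mk⇔; Equivalence)
open import Relation.Binary.Definitions using (tri<; tri≈; tri>)
open import Relation.Binary.PropositionalEquality using (_≡_; _≢_; refl; sym; trans; cong; cong₂; module ≡-Reasoning)
open import Relation.Nullary using (¬_; yes; no)

open ℕ-Sum +-0-commutativeMonoid using (sum; sum-cong-≗; ∑-distrib-+; ∑-comm)

Σ[Fin]≡sum : ∀ {n} (f : Fin n → ℕ) → Σ[Fin] f ≡ sum f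
Σ[Fin]≡sum {zero}  f = refl
Σ[Fin]≡sum {suc n} f = cong (f zero +_) (Σ[Fin]≡sum (f ∘ suc))

Σ-cong : ∀ {n} {f g : Fin n → ℕ} → (∀ i → f i ≡ g i) → Σ[Fin] f ≡ Σ[Fin] g
Σ-cong {zero}  f≗g = refl
Σ-cong {suc n} f≗g = cong₂ _+_ (f≗g zero) (Σ-cong (f≗g ∘ suc))

Σ-mono-≤ : ∀ {n} {f g : Fin n → ℕ} → (∀ i → f i ≤ g i) → Σ[Fin] f ≤ Σ[Fin] g
Σ-mono-≤ {zero}  f≤g = z≤n
Σ-mono-≤ {suc n} f≤g = +-mono-≤ (f≤g zero) (Σ-mono-≤ (f≤g ∘ suc))

Σ-const : ∀ n k → Σ[Fin] {n} (λ _ → k) ≡ n * k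
Σ-const zero    k = refl
Σ-const (suc n) k = cong (k +_) (Σ-const n k)

*-distribˡ-Σ : ∀ {n} k (f : Fin n → ℕ) → k * Σ[Fin] f ≡ Σ[Fin] (λ i → k * f i)
*-distribˡ-Σ {zero}  k f = *-zeroʳ k
*-distribˡ-Σ {suc n} k f = trans (*-distribˡ-+ k (f zero) _) (cong (k * f zero +_) (*-distribˡ-Σ k (f ∘ suc)))

Σ-distrib-+ : ∀ {n} (f g : Fin n → ℕ) → Σ[Fin] (λ i → f i + g i) ≡ Σ[Fin] f + Σ[Fin] g
Σ-distrib-+ f g = begin
  Σ[Fin] (λ i → f i + g i)  ≡⟨ Σ[Fin]≡sum (λ i → f i + g i) ⟩
  sum (λ i → f i + g i)     ≡⟨ ∑-distrib-+ f g ⟩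
  sum f + sum g             ≡⟨ cong₂ _+_ (Σ[Fin]≡sum f) (Σ[Fin]≡sum g) ⟨
  Σ[Fin] f + Σ[Fin] g       ∎
  where open ≡-Reasoning

Σ²≡sum² : ∀ {m n} (f : Fin m → Fin n → ℕ) →
          Σ[Fin] (λ i → Σ[Fin] (f i)) ≡ sum (λ i → sum (f i))
Σ²≡sum² f = trans (Σ[Fin]≡sum (λ i → Σ[Fin] (f i))) (sum-cong-≗ (Σ[Fin]≡sum ∘ f))

Σ-comm : ∀ {m n} (f : Fin m → Fin n → ℕ) →
         Σ[Fin] (λ i → Σ[Fin] (λ j → f i j)) ≡ Σ[Fin] (λ j → Σ[Fin] (λ i → f i j))
Σ-comm f = trans (Σ²≡sum² f) (trans (∑-comm f) (sym (Σ²≡sum² (flip f))))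

Σ²-distrib-+ : ∀ {m n} (f g : Fin m → Fin n → ℕ) →
  Σ[Fin] (λ i → Σ[Fin] (λ j → f i j + g i j)) ≡
  Σ[Fin] (λ i → Σ[Fin] (f i)) + Σ[Fin] (λ i → Σ[Fin] (g i))
Σ²-distrib-+ f g = trans (Σ-cong (λ i → Σ-distrib-+ (f i) (g i)))
                         (Σ-distrib-+ (λ i → Σ[Fin] (f i)) (λ i → Σ[Fin] (g i)))

[_<_] : ∀ {n} → Fin n → Fin n → ℕ
[ u < v ] with toℕ u <? toℕ v
... | yes _ = 1
... | no  _ = 0

[<]≡1 : ∀ {n} {u v : Fin n} → toℕ u < toℕ v → [ u < v ] ≡ 1
[<]≡1 {u = u} {v} u<v with toℕ u <? toℕ v
... | yes _   = refl
... | no  u≮v = ⊥-elim (u≮v u<v)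

[<]+[>]≤1 : ∀ {n} (u v : Fin n) → [ u < v ] + [ v < u ] ≤ 1
[<]+[>]≤1 u v with toℕ u <? toℕ v | toℕ v <? toℕ u
... | yes u<v | yes v<u = ⊥-elim (<-asym u<v v<u)
... | yes _   | no  _   = ≤-refl
... | no  _   | yes _   = ≤-refl
... | no  _   | no  _   = z≤n

-- For each v, h u occurs at most once: either as u < v or as v < u.
Σ-pairs-≤ : ∀ {n} (h : Fin n → ℕ) →
  Σ[Fin] (λ u → Σ[Fin] (λ v → [ u < v ] * (h u + h v))) ≤ n * Σ[Fin] h
Σ-pairs-≤ {n} h = begin
  Σ[Fin] (λ u → Σ[Fin] (λ v → [ u < v ] * (h u + h v)))
    ≡⟨ Σ-cong (λ u → Σ-cong (λ v → *-distribˡ-+ [ u < v ] (h u) (h v))) ⟩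
  Σ[Fin] (λ u → Σ[Fin] (λ v → [ u < v ] * h u + [ u < v ] * h v))
    ≡⟨ Σ²-distrib-+ (λ u v → [ u < v ] * h u) (λ u v → [ u < v ] * h v) ⟩
  Σ[Fin] (λ u → Σ[Fin] (λ v → [ u < v ] * h u)) + Σ[Fin] (λ u → Σ[Fin] (λ v → [ u < v ] * h v))
    ≡⟨ cong (Σ[Fin] (λ u → Σ[Fin] (λ v → [ u < v ] * h u)) +_) (Σ-comm (λ u v → [ u < v ] * h v)) ⟩
  Σ[Fin] (λ u → Σ[Fin] (λ v → [ u < v ] * h u)) + Σ[Fin] (λ u → Σ[Fin] (λ v → [ v < u ] * h u))
    ≡⟨ Σ²-distrib-+ (λ u v → [ u < v ] * h u) (λ u v → [ v < u ] * h u) ⟨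
  Σ[Fin] (λ u → Σ[Fin] (λ v → [ u < v ] * h u + [ v < u ] * h u))
    ≤⟨ Σ-mono-≤ (λ u → Σ-mono-≤ (λ v → weight-≤ u v)) ⟩
  Σ[Fin] (λ u → Σ[Fin] {n} (λ _ → h u))
    ≡⟨ Σ-cong (λ u → Σ-const n (h u)) ⟩
  Σ[Fin] (λ u → n * h u)
    ≡⟨ *-distribˡ-Σ n h ⟨
  n * Σ[Fin] h ∎
  where
  open ≤-Reasoning

  weight-≤ : ∀ u v → [ u < v ] * h u + [ v < u ] * h u ≤ h u
  weight-≤ u v = begin
    [ u < v ] * h u + [ v < u ] * h u  ≡⟨ *-distribʳ-+ (h u) [ u < v ] [ v < u ] ⟨
    ([ u < v ] + [ v < u ]) * h u      ≤⟨ *-monoˡ-≤ (h u) ([<]+[>]≤1 u v) ⟩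
    1 * h u                            ≡⟨ *-identityˡ (h u) ⟩
    h u                                ∎

infix 4 _≡_mod_

_≡_mod_ : ℕ → ℕ → (q : ℕ) → .{{NonZero q}} → Set
_≡_mod_ a b q = a % q ≡ b % q

module _ {q : ℕ} .{{_ : NonZero q}} where

  open ≡-Reasoning

  %-mod : ∀ a → a % q ≡ a mod q
  %-mod a = m%n%n≡m%n a q

  +q-mod : ∀ a → a + q ≡ a mod q
  +q-mod a = [m+n]%n≡m%n a q

  +-congˡ-mod : ∀ a {b b′} → b ≡ b′ mod q → a + b ≡ a + b′ mod q
  +-congˡ-mod a {b} {b′} b≡b′ = begin
    (a + b) % q              ≡⟨ %-distribˡ-+ a b q ⟩
    (a % q + b % q) % q      ≡⟨ cong (λ t → (a % q + t) % q) b≡b′ ⟩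
    (a % q + b′ % q) % q     ≡⟨ %-distribˡ-+ a b′ q ⟨
    (a + b′) % q             ∎

  +-congʳ-mod : ∀ {a a′} b → a ≡ a′ mod q → a + b ≡ a′ + b mod q
  +-congʳ-mod {a} {a′} b a≡a′ = begin
    (a + b) % q   ≡⟨ cong (_% q) (+-comm a b) ⟩
    (b + a) % q   ≡⟨ +-congˡ-mod b a≡a′ ⟩
    (b + a′) % q  ≡⟨ cong (_% q) (+-comm b a′) ⟩
    (a′ + b) % q  ∎

  -- Adding t · (q - 1) completes t to a multiple of q.
  +-cancelʳ-mod : ∀ a b t → a + t ≡ b + t mod q → a ≡ b mod q
  +-cancelʳ-mod a b t a+t≡b+t = begin
    a % q                         ≡⟨ [m+kn]%n≡m%n a t q ⟨
    (a + t * q) % q               ≡⟨ cong (_% q) (complete a) ⟩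
    (a + t + t * pred q) % q      ≡⟨ +-congʳ-mod (t * pred q) a+t≡b+t ⟩
    (b + t + t * pred q) % q      ≡⟨ cong (_% q) (complete b) ⟨
    (b + t * q) % q               ≡⟨ [m+kn]%n≡m%n b t q ⟩
    b % q                         ∎
    where
    complete : ∀ m → m + t * q ≡ m + t + t * pred q
    complete m = begin
      m + t * q               ≡⟨ cong (λ r → m + t * r) (suc-pred q) ⟨
      m + t * suc (pred q)    ≡⟨ cong (m +_) (*-suc t (pred q)) ⟩
      m + (t + t * pred q)    ≡⟨ +-assoc m t _ ⟨
      m + t + t * pred q      ∎

  ∸-mod⇔ : ∀ {a b c} → b ≤ q → c < q → ((a + q ∸ b) % q ≡ c) ⇔ (c + b ≡ a mod q)
  ∸-mod⇔ {a} {b} {c} b≤q c<q = mk⇔ to from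
    where
    a+q∸b+b : a + q ∸ b + b ≡ a + q
    a+q∸b+b = m∸n+n≡m (≤-trans b≤q (m≤n+m q a))

    to : (a + q ∸ b) % q ≡ c → c + b ≡ a mod q
    to a+q∸b≡c = begin
      (c + b) % q               ≡⟨ +-congʳ-mod b (trans (sym (%-mod (a + q ∸ b))) (cong (_% q) a+q∸b≡c)) ⟨
      (a + q ∸ b + b) % q       ≡⟨ cong (_% q) a+q∸b+b ⟩
      (a + q) % q               ≡⟨ +q-mod a ⟩
      a % q                     ∎

    from : c + b ≡ a mod q → (a + q ∸ b) % q ≡ c
    from c+b≡a = begin
      (a + q ∸ b) % q  ≡⟨ +-cancelʳ-mod (a + q ∸ b) c b (begin
                            (a + q ∸ b + b) % q  ≡⟨ cong (_% q) a+q∸b+b ⟩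
                            (a + q) % q          ≡⟨ +q-mod a ⟩
                            a % q                ≡⟨ c+b≡a ⟨
                            (c + b) % q          ∎) ⟩
      c % q            ≡⟨ m<n⇒m%n≡m c<q ⟩
      c                ∎

  -- Read a + y ≡ x as "a is the difference x − y".
  difference-trans-mod : ∀ {a b c x y z} →
    a + y ≡ x mod q → b + z ≡ y mod q → c + z ≡ x mod q → a + b ≡ c mod q
  difference-trans-mod {a} {b} {c} {x} {y} {z} a+y≡x b+z≡y c+z≡x = +-cancelʳ-mod (a + b) c z (begin
    (a + b + z) % q    ≡⟨ cong (_% q) (+-assoc a b z) ⟩
    (a + (b + z)) % q  ≡⟨ +-congˡ-mod a b+z≡y ⟩
    (a + y) % q        ≡⟨ a+y≡x ⟩
    x % q              ≡⟨ c+z≡x ⟨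
    (c + z) % q        ∎)

  difference-sym-mod : ∀ {b x y} → b ≤ q → b + y ≡ x mod q → q ∸ b + x ≡ y mod q
  difference-sym-mod {b} {x} {y} b≤q b+y≡x = begin
    (q ∸ b + x) % q        ≡⟨ +-congˡ-mod (q ∸ b) b+y≡x ⟨
    (q ∸ b + (b + y)) % q  ≡⟨ cong (_% q) (+-assoc (q ∸ b) b y) ⟨
    (q ∸ b + b + y) % q    ≡⟨ cong (λ t → (t + y) % q) (m∸n+n≡m b≤q) ⟩
    (q + y) % q            ≡⟨ cong (_% q) (+-comm q y) ⟩
    (y + q) % q            ≡⟨ +q-mod y ⟩
    y % q                  ∎

-- The summand of unsat is local to its where-block; unification recovers it as violation.
mutual
  violation : ∀ {q n} .{{_ : NonZero q}} → (Fin n → Fin n → Fin q) → (Fin n → Fin q) → Fin n → Fin n → ℕ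
  violation = _

  unsat≡Σviolation : ∀ {q n} .{{_ : NonZero q}} (c : Fin n → Fin n → Fin q) (x : Fin n → Fin q) →
    unsat c x ≡ Σ[Fin] (λ u → Σ[Fin] (violation c x u))
  unsat≡Σviolation c x = refl

module _ {q n : ℕ} .{{_ : NonZero q}} (c : Fin n → Fin n → Fin q) where

  satisfied⇔ : ∀ x u v → Satisfied c x u v ⇔ toℕ (c u v) + toℕ (x v) ≡ toℕ (x u) mod q
  satisfied⇔ x u v = ∸-mod⇔ (<⇒≤ (toℕ<n (x v))) (toℕ<n (c u v))

  violation≡0⇒satisfied : ∀ x {u v} → toℕ u < toℕ v → violation c x u v ≡ 0 → Satisfied c x u v
  violation≡0⇒satisfied x {u} {v} u<v v≡0 with toℕ u <? toℕ v | satisfied? c x u v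
  ... | _      | yes sat = sat
  ... | no u≮v | no  _   = ⊥-elim (u≮v u<v)
  violation≡0⇒satisfied x u<v () | yes _ | no _

  violation≢0⇒unsatisfied : ∀ x {u v} → violation c x u v ≢ 0 → toℕ u < toℕ v × ¬ Satisfied c x u v
  violation≢0⇒unsatisfied x {u} {v} v≢0 with toℕ u <? toℕ v | satisfied? c x u v
  ... | yes u<v | no ¬sat = u<v , ¬sat
  ... | yes _   | yes _   = ⊥-elim (v≢0 refl)
  ... | no  _   | _       = ⊥-elim (v≢0 refl)

  violation≤1 : ∀ x u v → violation c x u v ≤ 1
  violation≤1 x u v with toℕ u <? toℕ v | satisfied? c x u v
  ... | yes _ | no  _ = ≤-refl
  ... | yes _ | yes _ = z≤n
  ... | no  _ | _     = z≤n

  satisfied-sym : Consistent q n c → ∀ x {u v} → u ≢ v → Satisfied c x u v → Satisfied c x v u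
  satisfied-sym con x {u} {v} u≢v sat = Equivalence.from (satisfied⇔ x v u) (begin
    (toℕ (c v u) + toℕ (x u)) % q        ≡⟨ +-congʳ-mod (toℕ (x u)) c-antisym ⟩
    (q ∸ toℕ (c u v) + toℕ (x u)) % q    ≡⟨ difference-sym-mod (<⇒≤ (toℕ<n (c u v)))
                                                                (Equivalence.to (satisfied⇔ x u v) sat) ⟩
    toℕ (x v) % q                        ∎)
    where
    open ≡-Reasoning
    c-antisym : toℕ (c v u) ≡ q ∸ toℕ (c u v) mod q
    c-antisym = trans (cong (_% q) (con u v u≢v)) (%-mod (q ∸ toℕ (c u v)))

  satisfied-compose : ∀ x {u v p} → Satisfied c x u v → Satisfied c x u p → Satisfied c x v p →
    toℕ (c u v) + toℕ (c v p) ≡ toℕ (c u p) mod q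
  satisfied-compose x {u} {v} {p} uv up vp =
    difference-trans-mod (to (satisfied⇔ x u v) uv) (to (satisfied⇔ x v p) vp) (to (satisfied⇔ x u p) up)
    where open Equivalence

  edgeViolation : (Fin n → Fin q) → Fin n → Fin n → ℕ
  edgeViolation x u v = violation c x u v + violation c x v u

  edgeViolation≡0⇒satisfied : Consistent q n c → ∀ x {u v} → u ≢ v →
    edgeViolation x u v ≡ 0 → Satisfied c x u v
  edgeViolation≡0⇒satisfied con x {u} {v} u≢v e≡0 with <-cmp u v
  ... | tri< u<v _ _ = violation≡0⇒satisfied x u<v (m+n≡0⇒m≡0 _ e≡0)
  ... | tri≈ _ u≡v _ = ⊥-elim (u≢v u≡v)
  ... | tri> _ _ v<u = satisfied-sym con x (u≢v ∘ sym) (violation≡0⇒satisfied x v<u (m+n≡0⇒n≡0 _ e≡0))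

  Σ-edgeViolation : ∀ x → Σ[Fin] (λ p → Σ[Fin] (λ u → edgeViolation x u p)) ≡ unsat c x + unsat c x
  Σ-edgeViolation x = begin
    Σ[Fin] (λ p → Σ[Fin] (λ u → violation c x u p + violation c x p u))
      ≡⟨ Σ²-distrib-+ (λ p u → violation c x u p) (violation c x) ⟩
    Σ[Fin] (λ p → Σ[Fin] (λ u → violation c x u p)) + Σ[Fin] (λ p → Σ[Fin] (violation c x p))
      ≡⟨ cong (_+ Σ[Fin] (λ p → Σ[Fin] (violation c x p))) (Σ-comm (violation c x)) ⟨
    Σ[Fin] (λ u → Σ[Fin] (violation c x u)) + Σ[Fin] (λ p → Σ[Fin] (violation c x p))
      ≡⟨ cong₂ _+_ (unsat≡Σviolation c x) (unsat≡Σviolation c x) ⟨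
    unsat c x + unsat c x ∎
    where open ≡-Reasoning

-- pivotLabel computes only once the modulus is a successor.
module _ {k n : ℕ} (c : Fin n → Fin n → Fin (suc k)) (con : Consistent (suc k) n c) where

  pivotLabel-satisfied : ∀ x p {u v} → u ≢ v → Satisfied c x u v →
    (u ≢ p → Satisfied c x u p) → (v ≢ p → Satisfied c x v p) → Satisfied c (pivotLabel c p) u v
  pivotLabel-satisfied x p {u} {v} u≢v sat satᵤ satᵥ with u ≟ p | v ≟ p
  ... | yes refl | yes refl = ⊥-elim (u≢v refl)
  ... | yes refl | no  v≢p  = sym (con v u v≢p)
  ... | no  u≢p  | yes refl = trans ([m+n]%n≡m%n (toℕ (c u v)) (suc k)) (m<n⇒m%n≡m (toℕ<n (c u v)))
  ... | no  u≢p  | no  v≢p  =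
    Equivalence.from (∸-mod⇔ {a = toℕ (c u p)} (<⇒≤ (toℕ<n (c v p))) (toℕ<n (c u v)))
      (satisfied-compose c x sat (satᵤ u≢p) (satᵥ v≢p))

  pivot-violation-charged : ∀ x p {u v} → u ≢ v → Satisfied c x u v → ¬ Satisfied c (pivotLabel c p) u v →
    1 ≤ edgeViolation c x u p + edgeViolation c x v p
  pivot-violation-charged x p {u} {v} u≢v sat ¬satℓ
    with edgeViolation c x u p ≟ℕ 0 | edgeViolation c x v p ≟ℕ 0
  ... | yes eᵤ≡0 | yes eᵥ≡0 = ⊥-elim (¬satℓ (pivotLabel-satisfied x p u≢v sat
          (λ u≢p → edgeViolation≡0⇒satisfied c con x u≢p eᵤ≡0)
          (λ v≢p → edgeViolation≡0⇒satisfied c con x v≢p eᵥ≡0)))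
  ... | no  eᵤ≢0 | _         = ≤-trans (n≢0⇒n>0 eᵤ≢0) (m≤m+n _ _)
  ... | yes _    | no  eᵥ≢0 = ≤-trans (n≢0⇒n>0 eᵥ≢0) (m≤n+m _ (edgeViolation c x u p))

  violation-pivotLabel-≤ : ∀ x p u v → violation c (pivotLabel c p) u v ≤
    violation c x u v + [ u < v ] * (edgeViolation c x u p + edgeViolation c x v p)
  violation-pivotLabel-≤ x p u v with violation c x u v ≟ℕ 0 | violation c (pivotLabel c p) u v ≟ℕ 0
  ... | no  x≢0 | _       =
    ≤-trans (violation≤1 c (pivotLabel c p) u v) (≤-trans (n≢0⇒n>0 x≢0) (m≤m+n _ _))
  ... | yes _   | yes ℓ≡0 = ≤-trans (≤-reflexive ℓ≡0) z≤n
  ... | yes x≡0 | no  ℓ≢0 = begin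
    violation c (pivotLabel c p) u v       ≤⟨ violation≤1 c (pivotLabel c p) u v ⟩
    1                                      ≤⟨ pivot-violation-charged x p (<⇒≢ u<v) satₓ ¬satℓ ⟩
    charge                                 ≡⟨ *-identityˡ charge ⟨
    1 * charge                             ≡⟨ cong (_* charge) ([<]≡1 u<v) ⟨
    [ u < v ] * charge                     ≤⟨ m≤n+m _ (violation c x u v) ⟩
    violation c x u v + [ u < v ] * charge ∎
    where
    open ≤-Reasoning
    charge : ℕ
    charge = edgeViolation c x u p + edgeViolation c x v p
    u<v : toℕ u < toℕ v
    u<v = proj₁ (violation≢0⇒unsatisfied c (pivotLabel c p) ℓ≢0)
    ¬satℓ : ¬ Satisfied c (pivotLabel c p) u v
    ¬satℓ = proj₂ (violation≢0⇒unsatisfied c (pivotLabel c p) ℓ≢0)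
    satₓ : Satisfied c x u v
    satₓ = violation≡0⇒satisfied c x u<v x≡0

  unsat-pivotLabel-≤ : ∀ x p → unsat c (pivotLabel c p) ≤ unsat c x + n * Σ[Fin] (λ u → edgeViolation c x u p)
  unsat-pivotLabel-≤ x p = begin
    unsat c (pivotLabel c p)
      ≡⟨ unsat≡Σviolation c (pivotLabel c p) ⟩
    Σ[Fin] (λ u → Σ[Fin] (violation c (pivotLabel c p) u))
      ≤⟨ Σ-mono-≤ (λ u → Σ-mono-≤ (violation-pivotLabel-≤ x p u)) ⟩
    Σ[Fin] (λ u → Σ[Fin] (λ v → violation c x u v + charge u v))
      ≡⟨ Σ²-distrib-+ (violation c x) charge ⟩
    Σ[Fin] (λ u → Σ[Fin] (violation c x u)) + Σ[Fin] (λ u → Σ[Fin] (charge u))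
      ≡⟨ cong (_+ Σ[Fin] (λ u → Σ[Fin] (charge u))) (unsat≡Σviolation c x) ⟨
    unsat c x + Σ[Fin] (λ u → Σ[Fin] (charge u))
      ≤⟨ +-monoʳ-≤ (unsat c x) (Σ-pairs-≤ eₚ) ⟩
    unsat c x + n * Σ[Fin] eₚ ∎
    where
    open ≤-Reasoning
    eₚ : Fin n → ℕ
    eₚ u = edgeViolation c x u p
    charge : Fin n → Fin n → ℕ
    charge u v = [ u < v ] * (eₚ u + eₚ v)

theorem1 : (q n : ℕ) → .{{_ : NonZero q}} → (c : Fin n → Fin n → Fin q) → Consistent q n c →
    (x : Fin n → Fin q) → Σ[Fin] (λ p → unsat c (pivotLabel c p)) ≤ 3 * n * unsat c x
theorem1 zero    n ⦃ () ⦄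
theorem1 (suc k) n c con x = begin
  Σ[Fin] (λ p → unsat c (pivotLabel c p))       ≤⟨ Σ-mono-≤ (unsat-pivotLabel-≤ c con x) ⟩
  Σ[Fin] (λ p → U + n * Σ[Fin] (e p))           ≡⟨ Σ-distrib-+ (λ _ → U) (λ p → n * Σ[Fin] (e p)) ⟩
  Σ[Fin] {n} (λ _ → U) + Σ[Fin] (λ p → n * Σ[Fin] (e p))
                                                ≡⟨ cong₂ _+_ (Σ-const n U) (sym (*-distribˡ-Σ n (λ p → Σ[Fin] (e p)))) ⟩
  n * U + n * Σ[Fin] (λ p → Σ[Fin] (e p))       ≡⟨ cong (λ t → n * U + n * t) (Σ-edgeViolation c x) ⟩
  n * U + n * (U + U)                           ≡⟨ m*n+m*[n+n]≡3*m*n n U ⟩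
  3 * n * U                                     ∎
  where
  open ≤-Reasoning
  U : ℕ
  U = unsat c x
  e : Fin n → Fin n → ℕ
  e p u = edgeViolation c x u p
  m*n+m*[n+n]≡3*m*n : ∀ m n → m * n + m * (n + n) ≡ 3 * m * n
  m*n+m*[n+n]≡3*m*n = solve-∀
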